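{- Let $G$ be a connected graph with at least three vertices such that each vertex is either a cut-vertex or a simplicial vertex. If $e$ is an edge of $G$ that is not a cut edge, then $\gamma_{\rm wcon}(G)\leq\gamma_{\rm wcon}(G-e)\leq\gamma_{\rm wcon}(G)+1$.
   Context: A vertex $v$ is simplicial if $N_G[v]$ induces a complete graph; a cut-vertex is a vertex whose removal increases the number of components; an edge $e$ is a cut edge if $G-e$ is disconnected. A set $D$ is dominating if every vertex outside $D$ has a neighbour in $D$; weakly convex if for any $a,b\in D$ some shortest $(a-b)$-path in the graph lies in $D$. $\gamma_{\rm wcon}$ denotes the minimum size of a weakly convex dominating set. -}

module Defs where

open import Data.Nat using (ℕ; zero; suc; _≤_; _<_; _+_)
open import Data.Bool using (Bool; true; false; _∧_; _∨_; not; T)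
open import Data.Fin using (Fin)
open import Data.Fin.Properties using (_≟_)
open import Data.Fin.Subset using (Subset; _∈_; ∣_∣)
open import Data.Vec using (Vec; _∷_; []; head; last)
open import Data.Product using (Σ; ∃; ∃-syntax; _×_; _,_)
open import Relation.Nullary using (¬_; ⌊_⌋)
open import Relation.Binary.PropositionalEquality using (_≡_; _≢_)

Adj : ℕ → Set
Adj n = Fin n → Fin n → Bool

record Graph (n : ℕ) : Set where
  field
    adj   : Adj n
    sym   : ∀ x y → adj x y ≡ adj y x
    irref : ∀ x → adj x x ≡ false
open Graph public

IsWalk : ∀ {n k} → Adj n → Vec (Fin n) k → Set
IsWalk A []           = Data.Unit.⊤ where import Data.Unit
IsWalk A (x ∷ [])     = Data.Unit.⊤ where import Data.Unit
IsWalk A (x ∷ y ∷ xs) = T (A x y) × IsWalk A (y ∷ xs)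

WalkOfLength : ∀ {n} → Adj n → ℕ → Fin n → Fin n → Set
WalkOfLength {n} A k a b =
  Σ (Vec (Fin n) (suc k)) λ p → IsWalk A p × head p ≡ a × last p ≡ b

Reachable : ∀ {n} → Adj n → Fin n → Fin n → Set
Reachable A a b = ∃[ k ] WalkOfLength A k a b

Connected : ∀ {n} → Adj n → Set
Connected {n} A = ∀ (a b : Fin n) → Reachable A a b

AllIn : ∀ {n k} → Subset n → Vec (Fin n) k → Set
AllIn D []       = Data.Unit.⊤ where import Data.Unit
AllIn D (x ∷ xs) = x ∈ D × AllIn D xs

WeaklyConvex : ∀ {n} → Adj n → Subset n → Set
WeaklyConvex {n} A D =
  ∀ (a b : Fin n) → a ∈ D → b ∈ D →
    ∃[ k ] ( (Σ (Vec (Fin n) (suc k)) λ p →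
               IsWalk A p × head p ≡ a × last p ≡ b × AllIn D p)
           × (∀ j → j < k → ¬ WalkOfLength A j a b) )

Dominating : ∀ {n} → Adj n → Subset n → Set
Dominating {n} A D = ∀ (v : Fin n) → ¬ (v ∈ D) → ∃[ u ] (u ∈ D × T (A v u))

WCDS : ∀ {n} → Adj n → Subset n → Set
WCDS A D = WeaklyConvex A D × Dominating A D

IsGammaWcon : ∀ {n} → Adj n → ℕ → Set
IsGammaWcon A k = (∃[ D ] (WCDS A D × ∣ D ∣ ≡ k)) × (∀ D → WCDS A D → k ≤ ∣ D ∣)

removeVertex : ∀ {n} → Adj n → Fin n → Adj n
removeVertex A v x y = A x y ∧ not ⌊ x ≟ v ⌋ ∧ not ⌊ y ≟ v ⌋

removeEdge : ∀ {n} → Adj n → Fin n → Fin n → Adj n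
removeEdge A u v x y =
  A x y ∧ not ((⌊ x ≟ u ⌋ ∧ ⌊ y ≟ v ⌋) ∨ (⌊ x ≟ v ⌋ ∧ ⌊ y ≟ u ⌋))

-- Cut-vertex: removal increases the number of components, i.e. some two
-- vertices other than v that are joined in G are no longer joined in G - v.
IsCutVertex : ∀ {n} → Adj n → Fin n → Set
IsCutVertex A v = ∃[ a ] ∃[ b ] (a ≢ v × b ≢ v × Reachable A a b ×
                                  ¬ Reachable (removeVertex A v) a b)

InClosedNbhd : ∀ {n} → Adj n → Fin n → Fin n → Set
InClosedNbhd A v x = (x ≡ v) Data.Sum.⊎ T (A v x) where import Data.Sum

IsSimplicial : ∀ {n} → Adj n → Fin n → Set
IsSimplicial A v = ∀ x y → InClosedNbhd A v x → InClosedNbhd A v y → x ≢ y → T (A x y)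

IsCutEdge : ∀ {n} → Adj n → Fin n → Fin n → Set
IsCutEdge A u v = ¬ Connected (removeEdge A u v)

-- Call the vertices that the hypothesis declares cut-vertices the set C; all
-- other vertices are simplicial. A weakly convex dominating set of a connected
-- graph contains every cut-vertex (otherwise the dominated vertices on either
-- side stay joined through the set), and conversely every nonempty S ⊇ C is a
-- weakly convex dominating set of G: a shortest path never passes through a
-- simplicial vertex, and a vertex with no neighbour in C is adjacent to all
-- others. Deleting a non-cut edge uv keeps all cut-vertices, so an optimal set
-- of G - uv is one of G, which gives γ(G) ≤ γ(G - uv). Conversely, if u and v
-- have a common neighbour m, an optimal set of G together with m is a weakly
-- convex dominating set of G - uv; if they have none, then u and v are
-- cut-vertices and an optimal set of G already works.
module Submission where

open import Defs
open import Data.Nat using (ℕ; zero; suc; _≤_; _<_; _+_; z≤n; s≤s; _≤?_)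
open import Data.Nat.Properties
  using (≤-trans; ≤-reflexive; n≤1+n; n<1+n; m≤m+n; +-monoʳ-≤; +-suc; anyUpTo?)
open import Data.Nat.Induction using (<-rec)
open import Data.Bool using (Bool; true; false; T; _∧_; not)
open import Data.Bool.Properties using (T-∧; T-∨)
open import Data.Fin using (Fin)
open import Data.Maybe using (is-just)
open import Data.Fin.Properties using (_≟_; any?)
open import Data.Fin.Subset using (Subset; _∈_; _∉_; _⊆_; _∪_; ⁅_⁆; ∣_∣)
open import Data.Fin.Subset.Properties
  using (_∈?_; p⊆p∪q; q⊆p∪q; x∈⁅x⁆; ∣⁅x⁆∣≡1)
open import Data.Vec using (Vec; _∷_; []; head; last; tabulate)
open import Data.Vec.Properties using ([]=⇒lookup; lookup⇒[]=; lookup∘tabulate)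
open import Data.Product using (Σ; ∃-syntax; _×_; _,_; proj₁; proj₂; swap)
import Data.Product as Product
open import Data.Sum using (_⊎_; inj₁; inj₂)
import Data.Sum as Sum
open import Data.Unit using (tt)
open import Data.Empty using (⊥-elim)
open import Function using (_∘_; id; _⇔_; mk⇔; Equivalence)
open import Relation.Nullary using (¬_; Dec; yes; no; ⌊_⌋)
open import Relation.Nullary.Decidable
  using (map′; T?; _×-dec_; _⊎-dec_; toWitness; fromWitness; fromWitnessFalse; decidable-stable)
open import Relation.Binary.PropositionalEquality
  using (_≡_; _≢_; refl; trans; cong; subst)
  renaming (sym to ≡-sym)

open Equivalence using (to; from)

Edge : ∀ {n} → Adj n → Fin n → Fin n → Set
Edge A x y = T (A x y)

-- Explicit endpoints instead of the implicit ones of Relation.Binary's Symmetric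
-- and _⇒_: T is not injective, so endpoints cannot be inferred from an edge.
IsSymmetric : ∀ {n} → Adj n → Set
IsSymmetric A = ∀ x y → Edge A x y → Edge A y x

Subgraph : ∀ {n} → Adj n → Adj n → Set
Subgraph A′ A = ∀ x y → Edge A′ x y → Edge A x y

module _ {n : ℕ} (A : Adj n) where

  data Walk : Fin n → Fin n → ℕ → Set where
    nil  : ∀ {x} → Walk x x 0
    cons : ∀ {x y z k} → Edge A x y → Walk y z k → Walk x z (suc k)

  vertices : ∀ {a b k} → Walk a b k → Vec (Fin n) (suc k)
  vertices (nil {x})      = x ∷ []
  vertices (cons {x} _ w) = x ∷ vertices w

  head-vertices : ∀ {a b k} (w : Walk a b k) → head (vertices w) ≡ a
  head-vertices nil        = refl
  head-vertices (cons _ _) = refl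

  last-vertices : ∀ {a b k} (w : Walk a b k) → last (vertices w) ≡ b
  last-vertices nil                 = refl
  last-vertices (cons _ nil)        = refl
  last-vertices (cons _ (cons e w)) = last-vertices (cons e w)

  isWalk-vertices : ∀ {a b k} (w : Walk a b k) → IsWalk A (vertices w)
  isWalk-vertices nil                 = tt
  isWalk-vertices (cons e nil)        = e , tt
  isWalk-vertices (cons e (cons f w)) = e , isWalk-vertices (cons f w)

  fromIsWalk : ∀ {k} (p : Vec (Fin n) (suc k)) → IsWalk A p → Walk (head p) (last p) k
  fromIsWalk (x ∷ [])     _       = nil
  fromIsWalk (x ∷ y ∷ xs) (e , p) = cons e (fromIsWalk (y ∷ xs) p)

  Walk⇒WalkOfLength : ∀ {a b k} → Walk a b k → WalkOfLength A k a b
  Walk⇒WalkOfLength w = vertices w , isWalk-vertices w , head-vertices w , last-vertices w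

  WalkOfLength⇒Walk : ∀ {a b k} → WalkOfLength A k a b → Walk a b k
  WalkOfLength⇒Walk (p , walk , refl , refl) = fromIsWalk p walk

  walk? : ∀ k a b → Dec (Walk a b k)
  walk? zero    a b = map′ (λ { refl → nil }) (λ { nil → refl }) (a ≟ b)
  walk? (suc k) a b =
    map′ (λ (_ , e , w) → cons e w) (λ { (cons e w) → _ , e , w })
         (any? λ y → T? (A a y) ×-dec walk? k y b)

  first-edge : ∀ {a b k} → Walk a b k → a ≢ b → ∃[ y ] Edge A a y
  first-edge nil        a≢b = ⊥-elim (a≢b refl)
  first-edge (cons e _) _   = _ , e

  Shortest : Fin n → Fin n → ℕ → Set
  Shortest a b k = ∀ j → j < k → ¬ Walk a b j

  connected⇒walk : Connected A → ∀ a b → ∃[ k ] Walk a b k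
  connected⇒walk connected a b = Product.map₂ WalkOfLength⇒Walk (connected a b)

_++ʷ_ : ∀ {n} {A : Adj n} {a b c j k} → Walk A a b j → Walk A b c k → Walk A a c (j + k)
nil      ++ʷ w = w
cons e v ++ʷ w = cons e (v ++ʷ w)

walk-mono : ∀ {n} {A A′ : Adj n} → Subgraph A′ A → ∀ {a b k} → Walk A′ a b k → Walk A a b k
walk-mono A′⊆A nil                = nil
walk-mono A′⊆A (cons {x} {y} e w) = cons (A′⊆A x y e) (walk-mono A′⊆A w)

reachable-mono : ∀ {n} {A A′ : Adj n} → Subgraph A′ A → ∀ {a b} → Reachable A′ a b → Reachable A a b
reachable-mono A′⊆A (k , w) = k , Walk⇒WalkOfLength _ (walk-mono A′⊆A (WalkOfLength⇒Walk _ w))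

least-witness : ∀ {P : ℕ → Set} → (∀ j → Dec (P j)) → ∀ {k} → P k →
                ∃[ j ] (P j × (∀ i → i < j → ¬ P i))
least-witness {P} P? {k} = <-rec (λ k → P k → ∃[ j ] (P j × (∀ i → i < j → ¬ P i))) step k
  where
    step : ∀ k → (∀ {i} → i < k → P i → ∃[ j ] (P j × (∀ i → i < j → ¬ P i))) →
           P k → ∃[ j ] (P j × (∀ i → i < j → ¬ P i))
    step k smaller pk with anyUpTo? P? k
    ... | yes (i , i<k , pi) = smaller i<k pi
    ... | no none            = k , pk , λ i i<k pi → none (i , i<k , pi)

∈-tabulate⁺ : ∀ {n} (f : Fin n → Bool) {x} → f x ≡ true → x ∈ tabulate f
∈-tabulate⁺ f {x} fx = lookup⇒[]= x (tabulate f) (trans (lookup∘tabulate f x) fx)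

∈-tabulate⁻ : ∀ {n} (f : Fin n → Bool) {x} → x ∈ tabulate f → f x ≡ true
∈-tabulate⁻ f {x} x∈ = trans (≡-sym (lookup∘tabulate f x)) ([]=⇒lookup x∈)

∣p∪q∣≤∣p∣+∣q∣ : ∀ {n} (p q : Subset n) → ∣ p ∪ q ∣ ≤ ∣ p ∣ + ∣ q ∣
∣p∪q∣≤∣p∣+∣q∣ []          []          = z≤n
∣p∪q∣≤∣p∣+∣q∣ (true ∷ p)  (true ∷ q)  =
  s≤s (≤-trans (∣p∪q∣≤∣p∣+∣q∣ p q) (+-monoʳ-≤ ∣ p ∣ (n≤1+n ∣ q ∣)))
∣p∪q∣≤∣p∣+∣q∣ (true ∷ p)  (false ∷ q) = s≤s (∣p∪q∣≤∣p∣+∣q∣ p q)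
∣p∪q∣≤∣p∣+∣q∣ (false ∷ p) (true ∷ q)  =
  ≤-trans (s≤s (∣p∪q∣≤∣p∣+∣q∣ p q)) (≤-reflexive (≡-sym (+-suc ∣ p ∣ ∣ q ∣)))
∣p∪q∣≤∣p∣+∣q∣ (false ∷ p) (false ∷ q) = ∣p∪q∣≤∣p∣+∣q∣ p q

∣p∪⁅x⁆∣≤∣p∣+1 : ∀ {n} (p : Subset n) x → ∣ p ∪ ⁅ x ⁆ ∣ ≤ ∣ p ∣ + 1
∣p∪⁅x⁆∣≤∣p∣+1 p x =
  subst (λ t → ∣ p ∪ ⁅ x ⁆ ∣ ≤ ∣ p ∣ + t) (∣⁅x⁆∣≡1 x) (∣p∪q∣≤∣p∣+∣q∣ p ⁅ x ⁆)

module _ {n : ℕ} (A : Adj n) (x : Fin n) where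

  removeVertex⁺ : ∀ {p q} → Edge A p q → p ≢ x → q ≢ x → Edge (removeVertex A x) p q
  removeVertex⁺ {p} {q} e p≢x q≢x = from (T-∧ {A p q}) (e , from T-∧ (p∉ , q∉))
    where
      p∉ = fromWitnessFalse {a? = p ≟ x} p≢x
      q∉ = fromWitnessFalse {a? = q ≟ x} q≢x

  isWalk-avoiding : ∀ {D k} → x ∉ D → (p : Vec (Fin n) k) → AllIn D p →
                    IsWalk A p → IsWalk (removeVertex A x) p
  isWalk-avoiding x∉D []           _               _       = tt
  isWalk-avoiding x∉D (y ∷ [])     _               _       = tt
  isWalk-avoiding x∉D (y ∷ z ∷ ys) (y∈D , z∈D , D∋) (e , p) =
    removeVertex⁺ e (λ { refl → x∉D y∈D }) (λ { refl → x∉D z∈D }) ,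
    isWalk-avoiding x∉D (z ∷ ys) (z∈D , D∋) p

removeVertex-mono : ∀ {n} {A A′ : Adj n} → Subgraph A′ A →
                    ∀ x → Subgraph (removeVertex A′ x) (removeVertex A x)
removeVertex-mono {A = A} {A′} A′⊆A x p q e =
  from (T-∧ {A p q}) (Product.map₁ (A′⊆A p q) (to (T-∧ {A′ p q}) e))

isCutVertex-mono : ∀ {n} {A A′ : Adj n} → Subgraph A′ A → Connected A′ →
                   ∀ {x} → IsCutVertex A x → IsCutVertex A′ x
isCutVertex-mono A′⊆A connected′ {x} (a , b , a≢x , b≢x , _ , separated) =
  a , b , a≢x , b≢x , connected′ a b ,
  separated ∘ reachable-mono (removeVertex-mono A′⊆A x)

SameEdge : ∀ {n} → Fin n → Fin n → Fin n → Fin n → Set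
SameEdge u v p q = (p ≡ u × q ≡ v) ⊎ (p ≡ v × q ≡ u)

sameEdge? : ∀ {n} (u v p q : Fin n) → Dec (SameEdge u v p q)
sameEdge? u v p q = (p ≟ u ×-dec q ≟ v) ⊎-dec (p ≟ v ×-dec q ≟ u)

sameEdge-sym : ∀ {n} {u v p q : Fin n} → SameEdge u v p q → SameEdge u v q p
sameEdge-sym = Sum.swap ∘ Sum.map swap swap

T-∧-not : ∀ {b c} → T (b ∧ not c) ⇔ (T b × ¬ T c)
T-∧-not {true}  {true}  = mk⇔ (λ ()) (λ (_ , ¬c) → ¬c tt)
T-∧-not {true}  {false} = mk⇔ (λ _ → tt , λ ()) (λ _ → tt)
T-∧-not {false}         = mk⇔ (λ ()) (λ ())

removeEdge-spec : ∀ {n} (A : Adj n) (u v p q : Fin n) →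
                  Edge (removeEdge A u v) p q ⇔ (Edge A p q × ¬ SameEdge u v p q)
removeEdge-spec A u v p q = mk⇔
  (λ e → Product.map₂ (λ ¬t s → ¬t (from T-∨ (sameEdge⇒T s))) (to T-∧-not e))
  (λ (e , ¬s) → from T-∧-not (e , ¬s ∘ T⇒sameEdge ∘ to T-∨))
  where
    sameEdge⇒T : SameEdge u v p q → T (⌊ p ≟ u ⌋ ∧ ⌊ q ≟ v ⌋) ⊎ T (⌊ p ≟ v ⌋ ∧ ⌊ q ≟ u ⌋)
    sameEdge⇒T = Sum.map
      (λ (p≡u , q≡v) → from T-∧ (fromWitness {a? = p ≟ u} p≡u , fromWitness {a? = q ≟ v} q≡v))
      (λ (p≡v , q≡u) → from T-∧ (fromWitness {a? = p ≟ v} p≡v , fromWitness {a? = q ≟ u} q≡u))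
    T⇒sameEdge : T (⌊ p ≟ u ⌋ ∧ ⌊ q ≟ v ⌋) ⊎ T (⌊ p ≟ v ⌋ ∧ ⌊ q ≟ u ⌋) → SameEdge u v p q
    T⇒sameEdge = Sum.map (Product.map toWitness toWitness ∘ to (T-∧ {⌊ p ≟ u ⌋}))
                         (Product.map toWitness toWitness ∘ to (T-∧ {⌊ p ≟ v ⌋}))

removeEdge⊆ : ∀ {n} (A : Adj n) (u v : Fin n) → Subgraph (removeEdge A u v) A
removeEdge⊆ A u v p q = proj₁ ∘ to (removeEdge-spec A u v p q)

removeEdge⁺ : ∀ {n} (A : Adj n) (u v : Fin n) {p q} →
              Edge A p q → ¬ SameEdge u v p q → Edge (removeEdge A u v) p q
removeEdge⁺ A u v {p} {q} e ¬s = from (removeEdge-spec A u v p q) (e , ¬s)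

removeEdge-sym : ∀ {n} (A : Adj n) (u v : Fin n) → IsSymmetric A → IsSymmetric (removeEdge A u v)
removeEdge-sym A u v A-sym p q e with to (removeEdge-spec A u v p q) e
... | e′ , ¬s = removeEdge⁺ A u v (A-sym p q e′) (¬s ∘ sameEdge-sym)

module _ {n : ℕ} (A : Adj n) where

  cutVertex∈WCDS : IsSymmetric A → ∀ {D x} → WCDS A D → IsCutVertex A x → x ∈ D
  cutVertex∈WCDS A-sym {D} {x} (convex , dominating) (a , b , a≢x , b≢x , _ , separated)
    with x ∈? D
  ... | yes x∈D = x∈D
  ... | no x∉D  =
    let d  , d∈D  , (_ , a→d) , _          = intoD a≢x
        d′ , d′∈D , _          , (_ , d′→b) = intoD b≢x
        _  , d→d′ = withinD d∈D d′∈D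
    in  ⊥-elim (separated (_ , Walk⇒WalkOfLength A-x (a→d ++ʷ (d→d′ ++ʷ d′→b))))
    where
      A-x = removeVertex A x

      intoD : ∀ {a} → a ≢ x → ∃[ d ] (d ∈ D × (∃[ j ] Walk A-x a d j) × (∃[ j ] Walk A-x d a j))
      intoD {a} a≢x with a ∈? D
      ... | yes a∈D = a , a∈D , (0 , nil) , (0 , nil)
      ... | no a∉D with dominating a a∉D
      ... | d , d∈D , e = d , d∈D , (1 , cons (removeVertex⁺ A x e a≢x d≢x) nil)
                                 , (1 , cons (removeVertex⁺ A x (A-sym a d e) d≢x a≢x) nil)
        where d≢x : d ≢ x
              d≢x refl = x∉D d∈D

      withinD : ∀ {d d′} → d ∈ D → d′ ∈ D → ∃[ j ] Walk A-x d d′ j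
      withinD d∈D d′∈D with convex _ _ d∈D d′∈D
      ... | j , (p , walk , refl , refl , D∋p) , _ =
        j , fromIsWalk A-x p (isWalk-avoiding A x x∉D p D∋p walk)


  Shortcuts : Subset n → Set
  Shortcuts S = ∀ {a y z} → Edge A a y → Edge A y z → y ∉ S →
                a ≡ z ⊎ Edge A a z ⊎ ∃[ m ] (m ∈ S × Edge A a m × Edge A m z)

  module _ {S : Subset n} (shortcuts : Shortcuts S) where

    -- a shorter walk would contradict minimality, so only the third shortcut remains
    shortest-detour : ∀ {k a y z b} → Edge A a y → Edge A y z → Walk A z b k →
                      Shortest A a b (suc (suc k)) → ∃[ m ] (m ∈ S × Edge A a m × Edge A m z)
    shortest-detour {k} {y = y} a~y y~z w shortest with y ∈? S
    ... | yes y∈S = y , y∈S , a~y , y~z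
    ... | no y∉S with shortcuts a~y y~z y∉S
    ... | inj₁ refl               = ⊥-elim (shortest k (n≤1+n (suc k)) w)
    ... | inj₂ (inj₁ a~z)         = ⊥-elim (shortest (suc k) (n<1+n (suc k)) (cons a~z w))
    ... | inj₂ (inj₂ m-shortcut) = m-shortcut

    shortest-cons-into : ∀ {k a x b} → a ∈ S → b ∈ S → Edge A a x → Walk A x b k →
                         Shortest A a b (suc k) → Σ (Walk A a b (suc k)) (AllIn S ∘ vertices A)
    shortest-cons-into a∈S b∈S a~x nil          _        = cons a~x nil , a∈S , b∈S , tt
    shortest-cons-into a∈S b∈S a~x (cons x~z w) shortest =
      let m , m∈S , a~m , m~z = shortest-detour a~x x~z w shortest
          w′ , S∋w′ = shortest-cons-into m∈S b∈S m~z w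
                        (λ j j<k wj → shortest (suc j) (s≤s j<k) (cons a~m wj))
      in  cons a~m w′ , a∈S , S∋w′

    shortest-walk-into : ∀ {k a b} → a ∈ S → b ∈ S → Walk A a b k → Shortest A a b k →
                         Σ (Walk A a b k) (AllIn S ∘ vertices A)
    shortest-walk-into a∈S b∈S nil        _        = nil , a∈S , tt
    shortest-walk-into a∈S b∈S (cons e w) shortest = shortest-cons-into a∈S b∈S e w shortest

    shortcuts⇒weaklyConvex : Connected A → WeaklyConvex A S
    shortcuts⇒weaklyConvex connected a b a∈S b∈S
      with least-witness (λ j → walk? A j a b) (proj₂ (connected⇒walk A connected a b))
    ... | k , w , shortest with shortest-walk-into a∈S b∈S w shortest
    ... | w′ , S∋w′ =
      k , (vertices A w′ , isWalk-vertices A w′ , head-vertices A w′ , last-vertices A w′ , S∋w′) ,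
      λ j j<k wj → shortest j j<k (WalkOfLength⇒Walk A wj)

dominating-nonempty : ∀ {n} {A : Adj n} {D} → Dominating A D → Fin n → ∃[ d ] d ∈ D
dominating-nonempty {D = D} dominating x with x ∈? D
... | yes x∈D = x , x∈D
... | no x∉D  = Product.map₂ proj₁ (dominating x x∉D)

module CutOrSimplicial {n : ℕ} (G : Graph n) (connected : Connected (adj G))
  (cut-or-simplicial : ∀ v → IsCutVertex (adj G) v ⊎ IsSimplicial (adj G) v) where

  A = adj G

  A-sym : IsSymmetric A
  A-sym x y = subst T (Graph.sym G x y)

  adjacent⇒≢ : ∀ {p q} → Edge A p q → p ≢ q
  adjacent⇒≢ {p} e refl = subst T (Graph.irref G p) e

  isCut : Fin n → Bool
  isCut v = is-just (Sum.isInj₁ (cut-or-simplicial v))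

  C : Subset n
  C = tabulate isCut

  C-cutVertex : ∀ {y} → y ∈ C → IsCutVertex A y
  C-cutVertex {y} y∈C with cut-or-simplicial y | ∈-tabulate⁻ isCut y∈C
  ... | inj₁ cut | _ = cut

  ∉C-simplicial : ∀ {y} → y ∉ C → IsSimplicial A y
  ∉C-simplicial {y} y∉C with cut-or-simplicial y in eq
  ... | inj₂ simplicial = simplicial
  ... | inj₁ _          = ⊥-elim (y∉C (∈-tabulate⁺ isCut (cong (is-just ∘ Sum.isInj₁) eq)))

  C⊆WCDS : ∀ {D} → WCDS A D → C ⊆ D
  C⊆WCDS wcds y∈C = cutVertex∈WCDS A A-sym wcds (C-cutVertex y∈C)

  through-simplicial : ∀ {a y z} → y ∉ C → Edge A a y → Edge A y z → a ≡ z ⊎ Edge A a z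
  through-simplicial {a} {y} {z} y∉C a~y y~z with a ≟ z
  ... | yes a≡z = inj₁ a≡z
  ... | no a≢z  = inj₂ (∉C-simplicial y∉C a z (inj₂ (A-sym a y a~y)) (inj₂ y~z) a≢z)

  closedNbhd-closed : ∀ {x p q} → (∀ y → Edge A x y → y ∉ C) →
                      InClosedNbhd A x p → Edge A p q → InClosedNbhd A x q
  closedNbhd-closed nbrs∉C (inj₁ refl) p~q = inj₂ p~q
  closedNbhd-closed {p = p} nbrs∉C (inj₂ x~p) p~q =
    Sum.map₁ ≡-sym (through-simplicial (nbrs∉C p x~p) x~p p~q)

  -- N[x] is closed under adjacency, so by connectivity it contains every vertex.
  no-cut-neighbour⇒universal : ∀ {x} → (∀ y → Edge A x y → y ∉ C) → ∀ z → z ≢ x → Edge A x z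
  no-cut-neighbour⇒universal {x} nbrs∉C z z≢x =
    Sum.[ ⊥-elim ∘ z≢x , id ] (along (proj₂ (connected⇒walk A connected x z)) (inj₁ refl))
    where
      along : ∀ {p q k} → Walk A p q k → InClosedNbhd A x p → InClosedNbhd A x q
      along nil        p∈N = p∈N
      along (cons e w) p∈N = along w (closedNbhd-closed nbrs∉C p∈N e)

  dominating-⊇C : ∀ {S w} → C ⊆ S → w ∈ S → Dominating A S
  dominating-⊇C {w = w} C⊆S w∈S x x∉S with any? (λ y → T? (A x y) ×-dec (y ∈? C))
  ... | yes (y , x~y , y∈C) = y , C⊆S y∈C , x~y
  ... | no none = w , w∈S ,
    no-cut-neighbour⇒universal (λ y x~y y∈C → none (y , x~y , y∈C)) w (λ { refl → x∉S w∈S })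

  shortcuts-⊇C : ∀ {S} → C ⊆ S → Shortcuts A S
  shortcuts-⊇C C⊆S a~y y~z y∉S = Sum.map₂ inj₁ (through-simplicial (y∉S ∘ C⊆S) a~y y~z)

  wcds-⊇C : ∀ {S w} → C ⊆ S → w ∈ S → WCDS A S
  wcds-⊇C C⊆S w∈S = shortcuts⇒weaklyConvex A (shortcuts-⊇C C⊆S) connected , dominating-⊇C C⊆S w∈S

  lonely-endpoint∈C : ∀ {p q} → Edge A p q → ∃[ y ] (Edge A p y × y ≢ q) →
                      ¬ (∃[ m ] (Edge A p m × Edge A m q)) → p ∈ C
  lonely-endpoint∈C {p} {q} p~q (y , p~y , y≢q) none with p ∈? C
  ... | yes p∈C = p∈C
  ... | no p∉C  = ⊥-elim (none (y , p~y , ∉C-simplicial p∉C y q (inj₂ p~y) (inj₂ p~q) y≢q))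

  module WithoutEdge (u v : Fin n) (u~v : Edge A u v) (connected′ : Connected (removeEdge A u v)) where

    A′ = removeEdge A u v

    A′-sym : IsSymmetric A′
    A′-sym = removeEdge-sym A u v A-sym

    C⊆WCDS′ : ∀ {D} → WCDS A′ D → C ⊆ D
    C⊆WCDS′ wcds y∈C =
      cutVertex∈WCDS A′ A′-sym wcds (isCutVertex-mono (removeEdge⊆ A u v) connected′ (C-cutVertex y∈C))

    CommonNeighbour : Fin n → Set
    CommonNeighbour m = Edge A u m × Edge A m v

    ContainsCommonNeighbour : Subset n → Set
    ContainsCommonNeighbour S = ∃[ y ] CommonNeighbour y → ∃[ m ] (m ∈ S × CommonNeighbour m)

    common-neighbour-edges : ∀ {m} → CommonNeighbour m → Edge A′ u m × Edge A′ m v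
    common-neighbour-edges {m} (u~m , m~v) =
      removeEdge⁺ A u v u~m ¬uv-um , removeEdge⁺ A u v m~v ¬uv-mv
      where
        ¬uv-um : ¬ SameEdge u v u m
        ¬uv-um (inj₁ (_ , m≡v)) = adjacent⇒≢ m~v m≡v
        ¬uv-um (inj₂ (u≡v , _)) = adjacent⇒≢ u~v u≡v
        ¬uv-mv : ¬ SameEdge u v m v
        ¬uv-mv (inj₁ (m≡u , _)) = adjacent⇒≢ u~m (≡-sym m≡u)
        ¬uv-mv (inj₂ (_ , v≡u)) = adjacent⇒≢ u~v (≡-sym v≡u)

    detour-around-uv : ∀ {S a y z} → ContainsCommonNeighbour S → SameEdge u v a z →
                       Edge A a y → Edge A y z → ∃[ m ] (m ∈ S × Edge A′ a m × Edge A′ m z)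
    detour-around-uv {y = y} has (inj₁ (refl , refl)) u~y y~v =
      let m , m∈S , c = has (y , u~y , y~v)
      in  m , m∈S , common-neighbour-edges c
    detour-around-uv {y = y} has (inj₂ (refl , refl)) v~y y~u =
      let m , m∈S , c = has (y , A-sym y u y~u , A-sym v y v~y)
          u~m , m~v   = common-neighbour-edges c
      in  m , m∈S , A′-sym m v m~v , A′-sym u m u~m

    shortcuts′ : ∀ {S} → C ⊆ S → ContainsCommonNeighbour S → Shortcuts A′ S
    shortcuts′ C⊆S has {a} {y} {z} a~y y~z y∉S
      with through-simplicial (y∉S ∘ C⊆S) (removeEdge⊆ A u v a y a~y) (removeEdge⊆ A u v y z y~z)
    ... | inj₁ a≡z = inj₁ a≡z
    ... | inj₂ a~z with sameEdge? u v a z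
    ... | yes uv-az = inj₂ (inj₂ (detour-around-uv has uv-az (removeEdge⊆ A u v a y a~y)
                                                         (removeEdge⊆ A u v y z y~z)))
    ... | no ¬uv-az = inj₂ (inj₁ (removeEdge⁺ A u v a~z ¬uv-az))

    dominating′ : ∀ {S w} → C ⊆ S → w ∈ S →
                  (u ∉ S → ∃[ y ] (y ∈ S × Edge A′ u y)) → (v ∉ S → ∃[ y ] (y ∈ S × Edge A′ v y)) →
                  Dominating A′ S
    dominating′ {S} C⊆S w∈S dominated-u dominated-v x x∉S = by-cases (x ≟ u) (x ≟ v)
      where
        by-cases : Dec (x ≡ u) → Dec (x ≡ v) → ∃[ y ] (y ∈ S × Edge A′ x y)
        by-cases (yes refl) _          = dominated-u x∉S
        by-cases (no _)     (yes refl) = dominated-v x∉S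
        by-cases (no x≢u)   (no x≢v)   =
          let y , y∈S , x~y = dominating-⊇C C⊆S w∈S x x∉S
          in  y , y∈S , removeEdge⁺ A u v x~y Sum.[ x≢u ∘ proj₁ , x≢v ∘ proj₁ ]

    wcds-with-common-neighbour : ∀ {S m} → C ⊆ S → m ∈ S → CommonNeighbour m → WCDS A′ S
    wcds-with-common-neighbour {m = m} C⊆S m∈S c =
      shortcuts⇒weaklyConvex A′ (shortcuts′ C⊆S (λ _ → m , m∈S , c)) connected′ ,
      dominating′ C⊆S m∈S (λ _ → m , m∈S , u~m) (λ _ → m , m∈S , A′-sym m v m~v)
      where
        u~m = proj₁ (common-neighbour-edges c)
        m~v = proj₂ (common-neighbour-edges c)

    other-neighbour : ∀ {p q} → SameEdge u v p q → ∃[ y ] (Edge A p y × y ≢ q)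
    other-neighbour {p} {q} uv-pq =
      let y , p~y      = first-edge A′ (proj₂ (connected⇒walk A′ connected′ p q)) p≢q
          p~y′ , ¬uv-py = to (removeEdge-spec A u v p y) p~y
      in  y , p~y′ , λ y≡q → ¬uv-py (subst (SameEdge u v p) (≡-sym y≡q) uv-pq)
      where
        p≢q : p ≢ q
        p≢q = Sum.[ (λ { (refl , refl) → adjacent⇒≢ u~v })
                  , (λ { (refl , refl) → adjacent⇒≢ u~v ∘ ≡-sym }) ] uv-pq

    -- Otherwise a simplicial endpoint would make its other neighbour (which exists
    -- because uv is not a cut edge) a common neighbour.
    endpoints∈C : ¬ (∃[ m ] CommonNeighbour m) → u ∈ C × v ∈ C
    endpoints∈C none =
      lonely-endpoint∈C u~v (other-neighbour (inj₁ (refl , refl))) none ,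
      lonely-endpoint∈C (A-sym u v u~v) (other-neighbour (inj₂ (refl , refl)))
        (λ (m , v~m , m~u) → none (m , A-sym m u m~u , A-sym v m v~m))

    wcds-without-common-neighbour : ∀ {S} → C ⊆ S → ¬ (∃[ m ] CommonNeighbour m) → WCDS A′ S
    wcds-without-common-neighbour C⊆S none =
      shortcuts⇒weaklyConvex A′ (shortcuts′ C⊆S (⊥-elim ∘ none)) connected′ ,
      dominating′ C⊆S u∈S (λ u∉S → ⊥-elim (u∉S u∈S)) (λ v∉S → ⊥-elim (v∉S v∈S))
      where
        u∈S = C⊆S (proj₁ (endpoints∈C none))
        v∈S = C⊆S (proj₂ (endpoints∈C none))

    wcds-extension : ∀ {D} → C ⊆ D → ∃[ S ] (WCDS A′ S × ∣ S ∣ ≤ ∣ D ∣ + 1)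
    wcds-extension {D} C⊆D with any? (λ m → T? (A u m) ×-dec T? (A m v))
    ... | yes (m , c) = D ∪ ⁅ m ⁆ ,
      wcds-with-common-neighbour (p⊆p∪q ⁅ m ⁆ ∘ C⊆D) (q⊆p∪q D ⁅ m ⁆ (x∈⁅x⁆ m)) c ,
      ∣p∪⁅x⁆∣≤∣p∣+1 D m
    ... | no none = D , wcds-without-common-neighbour C⊆D none , m≤m+n ∣ D ∣ 1

    γwcon-mono : ∀ {k k′} → IsGammaWcon A k → IsGammaWcon A′ k′ → k ≤ k′
    γwcon-mono (_ , minimal) ((D′ , wcds′ , refl) , _) =
      minimal D′ (wcds-⊇C (C⊆WCDS′ wcds′) (proj₂ (dominating-nonempty (proj₂ wcds′) u)))

    γwcon-≤-suc : ∀ {k k′} → IsGammaWcon A k → IsGammaWcon A′ k′ → k′ ≤ k + 1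
    γwcon-≤-suc ((D , wcds , refl) , _) (_ , minimal′) with wcds-extension (C⊆WCDS wcds)
    ... | S , wcds′ , ∣S∣≤∣D∣+1 = ≤-trans (minimal′ S wcds′) ∣S∣≤∣D∣+1

-- G - uv is only known to be ¬ ¬ connected, which suffices as the conclusion is decidable.
corollary4p5 : (n : ℕ) → 3 ≤ n → (G : Graph n) → Connected (adj G) →
    (∀ v → IsCutVertex (adj G) v ⊎ IsSimplicial (adj G) v) →
    (u v : Fin n) → T (adj G u v) → ¬ IsCutEdge (adj G) u v →
    (k k′ : ℕ) → IsGammaWcon (adj G) k → IsGammaWcon (removeEdge (adj G) u v) k′ →
    k ≤ k′ × k′ ≤ k + 1
corollary4p5 n _ G connected cut-or-simplicial u v u~v not-cut-edge k k′ γ γ′ =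
  decidable-stable ((k ≤? k′) ×-dec (k′ ≤? k + 1)) λ ¬bounds →
    not-cut-edge λ connected′ →
      let open CutOrSimplicial.WithoutEdge G connected cut-or-simplicial u v u~v connected′
      in  ¬bounds (γwcon-mono γ γ′ , γwcon-≤-suc γ γ′)
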